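{- Let $\mathcal{D}_i=(G_i,x_i,y_i)$ $(i=1,2)$ be regular dessins with $\gcd(|G_1|,|G_2|)=1$, and let $\mathcal{D}$ be their parallel product. Then for any $\sigma\in\mathrm{Aut}(\Delta)$, $\mathcal{D}$ possesses the external symmetry $\sigma$ if and only if both $\mathcal{D}_1$ and $\mathcal{D}_2$ possess the external symmetry $\sigma$.
   Context: A regular dessin is a triple $(G,x,y)$ with $G$ a finite group generated by $x,y$. The parallel product of $(G_1,x_1,y_1)$ and $(G_2,x_2,y_2)$ is $(G,x,y)$ where $x=(x_1,x_2)$, $y=(y_1,y_2)$ and $G=\langle x,y\rangle\le G_1\times G_2$. Let $\Delta=\langle X,Y\mid -\rangle$ be the free group of rank 2. For $\sigma\in\mathrm{Aut}(\Delta)$ with $\sigma(X)=u(X,Y)$, $\sigma(Y)=v(X,Y)$, a dessin $(G,x,y)$ possesses the external symmetry $\sigma$ if the assignment $x\mapsto u(x,y)$, $y\mapsto v(x,y)$ extends to an automorphism of $G$. -}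

module Defs where

open import Level using (Level; _⊔_; 0ℓ)
open import Data.Bool using (Bool; true; false; if_then_else_; not)
open import Data.Nat using (ℕ)
open import Data.Fin using (Fin)
open import Data.List using (List; []; _∷_; _++_; reverse; map)
open import Data.Product using (Σ; ∃; _×_; _,_; proj₁; proj₂)
open import Relation.Binary.PropositionalEquality as ≡ using (_≡_)
open import Relation.Nullary using (yes; no)
open import Function.Bundles using (Inverse)
open import Algebra.Bundles using (Group)
import Algebra.Construct.DirectProduct as DP
open import Algebra.Morphism.Structures using (module GroupMorphisms)
import Algebra.Properties.Group as GP

private variable c ℓ c₁ ℓ₁ c₂ ℓ₂ : Level

-- Words in the free group Δ = ⟨X, Y | -⟩ of rank 2

data Gen : Set where
  X Y : Gen

-- a letter: (false , g) is g, (true , g) is g⁻¹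
Letter : Set
Letter = Bool × Gen

Word : Set
Word = List Letter

invLetter : Letter → Letter
invLetter (b , g) = (not b , g)

invWord : Word → Word
invWord w = reverse (map invLetter w)

_≟G_ : (g h : Gen) → Relation.Nullary.Dec (g ≡ h)
X ≟G X = yes ≡.refl
X ≟G Y = no (λ ())
Y ≟G X = no (λ ())
Y ≟G Y = yes ≡.refl

cancels : Letter → Letter → Bool
cancels (b , g) (b' , g') with g ≟G g'
... | yes _ = if b then not b' else b'
... | no _  = false

push : Letter → Word → Word
push l []        = l ∷ []
push l (l' ∷ w)  = if cancels l l' then w else l ∷ l' ∷ w

reduce : Word → Word
reduce []      = []
reduce (l ∷ w) = push l (reduce w)

-- equality in the free group Δ: same freely reduced form
_≈Δ_ : Word → Word → Set
w ≈Δ w' = reduce w ≡ reduce w'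

substLetter : Word → Word → Letter → Word
substLetter u v (false , X) = u
substLetter u v (true  , X) = invWord u
substLetter u v (false , Y) = v
substLetter u v (true  , Y) = invWord v

substW : Word → Word → Word → Word
substW u v []      = []
substW u v (l ∷ w) = substLetter u v l ++ substW u v w

-- σ : X ↦ u, Y ↦ v is an automorphism of Δ: it has a two-sided inverse
-- endomorphism τ : X ↦ u', Y ↦ v'.
IsAutΔ : Word → Word → Set
IsAutΔ u v = Σ Word λ u' → Σ Word λ v' →
  (substW u v u' ≈Δ ((false , X) ∷ [])) × (substW u v v' ≈Δ ((false , Y) ∷ [])) ×
  (substW u' v' u ≈Δ ((false , X) ∷ [])) × (substW u' v' v ≈Δ ((false , Y) ∷ []))

module _ (G : Group c ℓ) where
  open Group G

  evalLetter : Carrier → Carrier → Letter → Carrier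
  evalLetter x y (false , X) = x
  evalLetter x y (true  , X) = x ⁻¹
  evalLetter x y (false , Y) = y
  evalLetter x y (true  , Y) = y ⁻¹

  eval : Carrier → Carrier → Word → Carrier
  eval x y []      = ε
  eval x y (l ∷ w) = evalLetter x y l ∙ eval x y w

  Generates : Carrier → Carrier → Set (c ⊔ ℓ)
  Generates x y = ∀ g → ∃ λ (w : Word) → eval x y w ≈ g

  HasOrder : ℕ → Set (c ⊔ ℓ)
  HasOrder n = Inverse setoid (≡.setoid (Fin n))

  eval-++ : ∀ x y w w' → eval x y (w ++ w') ≈ eval x y w ∙ eval x y w'
  eval-++ x y []      w' = sym (identityˡ _)
  eval-++ x y (l ∷ w) w' = trans (∙-congˡ (eval-++ x y w w')) (sym (assoc _ _ _))

  evalLetter-inv : ∀ x y l → evalLetter x y (invLetter l) ≈ evalLetter x y l ⁻¹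
  evalLetter-inv x y (false , X) = refl
  evalLetter-inv x y (true  , X) = sym (GP.⁻¹-involutive G x)
  evalLetter-inv x y (false , Y) = refl
  evalLetter-inv x y (true  , Y) = sym (GP.⁻¹-involutive G y)

  eval-inv : ∀ x y w → eval x y (invWord w) ≈ eval x y w ⁻¹
  eval-inv x y [] = sym (GP.ε⁻¹≈ε G)
  eval-inv x y (l ∷ w) = begin
      eval x y (reverse (invLetter l ∷ map invLetter w))
        ≈⟨ reflexive (≡.cong (eval x y) (Data.List.Properties.unfold-reverse (invLetter l) (map invLetter w))) ⟩
      eval x y (invWord w ++ invLetter l ∷ [])
        ≈⟨ eval-++ x y (invWord w) (invLetter l ∷ []) ⟩
      eval x y (invWord w) ∙ (evalLetter x y (invLetter l) ∙ ε)
        ≈⟨ ∙-cong (eval-inv x y w) (trans (identityʳ _) (evalLetter-inv x y l)) ⟩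
      eval x y w ⁻¹ ∙ evalLetter x y l ⁻¹
        ≈⟨ sym (GP.⁻¹-anti-homo-∙ G _ _) ⟩
      (evalLetter x y l ∙ eval x y w) ⁻¹ ∎
    where open import Relation.Binary.Reasoning.Setoid setoid
          import Data.List.Properties

  generated : Carrier → Carrier → Group (c ⊔ ℓ) ℓ
  generated x y = record
    { Carrier = Σ Carrier λ g → ∃ λ (w : Word) → eval x y w ≈ g
    ; _≈_ = λ a b → proj₁ a ≈ proj₁ b
    ; _∙_ = λ { (g , w , p) (h , w' , q) →
                 (g ∙ h , w ++ w' , trans (eval-++ x y w w') (∙-cong p q)) }
    ; ε = (ε , [] , refl)
    ; _⁻¹ = λ { (g , w , p) → (g ⁻¹ , invWord w , trans (eval-inv x y w) (⁻¹-cong p)) }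
    ; isGroup = record
      { isMonoid = record
        { isSemigroup = record
          { isMagma = record
            { isEquivalence = record { refl = refl ; sym = sym ; trans = trans }
            ; ∙-cong = ∙-cong }
          ; assoc = λ a b c → assoc (proj₁ a) (proj₁ b) (proj₁ c) }
        ; identity = (λ a → identityˡ (proj₁ a)) , (λ a → identityʳ (proj₁ a)) }
      ; inverse = (λ a → inverseˡ (proj₁ a)) , (λ a → inverseʳ (proj₁ a))
      ; ⁻¹-cong = ⁻¹-cong }
    }

record Dessin (c ℓ : Level) : Set (Level.suc (c ⊔ ℓ)) where
  field
    grp   : Group c ℓ
    x y   : Group.Carrier grp
    order : ℕ
    finite : HasOrder grp order
    gen   : Generates grp x y

parallelGroup : Dessin c₁ ℓ₁ → Dessin c₂ ℓ₂ → Group (c₁ ⊔ c₂ ⊔ ℓ₁ ⊔ ℓ₂) (ℓ₁ ⊔ ℓ₂)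
parallelGroup D₁ D₂ =
  generated (DP.group (Dessin.grp D₁) (Dessin.grp D₂))
            (Dessin.x D₁ , Dessin.x D₂) (Dessin.y D₁ , Dessin.y D₂)

parallelX : (D₁ : Dessin c₁ ℓ₁) (D₂ : Dessin c₂ ℓ₂) → Group.Carrier (parallelGroup D₁ D₂)
parallelX D₁ D₂ = ((Dessin.x D₁ , Dessin.x D₂) , (false , X) ∷ [] ,
  Group.identityʳ (DP.group (Dessin.grp D₁) (Dessin.grp D₂)) _)

parallelY : (D₁ : Dessin c₁ ℓ₁) (D₂ : Dessin c₂ ℓ₂) → Group.Carrier (parallelGroup D₁ D₂)
parallelY D₁ D₂ = ((Dessin.y D₁ , Dessin.y D₂) , (false , Y) ∷ [] ,
  Group.identityʳ (DP.group (Dessin.grp D₁) (Dessin.grp D₂)) _)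

HasSymmetry : (G : Group c ℓ) → (x y : Group.Carrier G) → Word → Word → Set (c ⊔ ℓ)
HasSymmetry G x y u v =
  Σ (Group.Carrier G → Group.Carrier G) λ f →
    GroupMorphisms.IsGroupIsomorphism (Group.rawGroup G) (Group.rawGroup G) f ×
    Group._≈_ G (f x) (eval G x y u) × Group._≈_ G (f y) (eval G x y v)

module Submission where

-- Idea.  Let τ = (u', v') be the inverse of σ.  For generators x, y of a group,
-- σ is an external symmetry iff σ and τ both preserve every relation w = w' of
-- (x, y) (SymmetryCriterion).  Words are evaluated componentwise in P, so the
-- relations of P are the relations common to both factors (Parallel).  If w = w'
-- holds in G₁, then c = w w'⁻¹ is trivial in G₁ and, by Lagrange, c^|G₂| is trivial in
-- both factors; preserving that relation of P and cancelling the exponent |G₂|,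
-- coprime to |G₁|, shows that σ preserves w = w' in G₁ (jointly⇒respects₁).

open import Level using (Level; _⊔_)
open import Data.Bool using (true; false)
open import Defs
open import Algebra.Bundles using (Group)
import Algebra.Properties.Group as GroupProperties
import Algebra.Construct.DirectProduct as DP
open import Algebra.Morphism.Structures using (module GroupMorphisms)
open import Data.Nat using (ℕ; zero; suc; _+_; _*_; _∸_; _<_; s≤s; z≤n; _<?_; NonZero; >-nonZero)
open import Data.Nat.GCD using (gcd; gcd-comm; gcd-GCD; module Bézout)
open import Data.Nat.DivMod using (_%_; _/_; m≡m%n+[m/n]*n; m%n<n)
open import Data.Nat.Properties using (m<n+m; anyUpTo?; <⇒≤; ≤-<-trans; m∸n≤m; m<n⇒0<n∸m; m∸n+n≡m; n<1+n)
open import Data.Nat.Divisibility using (_∣_; divides; _∣0; ∣-refl; ∣m∣n⇒∣m+n)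
open import Data.Nat.Induction using (<-rec)
open import Data.Fin using (Fin; toℕ)
import Data.Fin.Properties as Fin
open import Data.List using (List; []; _∷_; _++_; length; filter; applyUpTo; allFin; concat; replicate)
open import Data.List.Properties using (length-++; length-applyUpTo; length-tabulate)
open import Data.List.Membership.Propositional using (_∈_; _∉_)
open import Data.List.Membership.Propositional.Properties
  using (∈-++⁺ˡ; ∈-++⁺ʳ; ∈-++⁻; ∈-filter⁺; ∈-filter⁻; ∈-applyUpTo⁺; ∈-applyUpTo⁻; ∈-allFin)
open import Data.List.Membership.Propositional.Properties.WithK using (unique∧set⇒bag)
open import Data.List.Relation.Unary.Any using (here)
open import Data.List.Relation.Unary.Unique.Propositional using (Unique)
import Data.List.Relation.Unary.Unique.Propositional.Properties as Unique
open import Data.List.Relation.Binary.BagAndSetEquality using (∼bag⇒↭)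
open import Data.List.Relation.Binary.Permutation.Propositional.Properties using (↭-length)
open import Data.List.Relation.Binary.Subset.Propositional using (_⊆_)
open import Data.Product using (_×_; _,_; proj₁; proj₂; ∃; swap; map)
open import Data.Sum using (inj₁; inj₂)
open import Function.Bundles using (_⇔_; mk⇔; Equivalence; Inverse)
open import Function.Properties.Equivalence using () renaming (sym to ⇔-sym)
open import Function.Related.Propositional using (module EquationalReasoning)
open import Relation.Binary.Definitions using (DecidableEquality)
open import Relation.Binary.PropositionalEquality as ≡ using (_≡_)
open import Relation.Nullary using (Dec; yes; no; ¬_; ¬?; _×-dec_)
open import Relation.Unary using (Decidable)

module _ {a} {A : Set a} (_≟_ : DecidableEquality A) where
  open import Data.List.Membership.DecPropositional _≟_ using (_∈?_)

  _∉?_ : (z : A) (B : List A) → Dec (z ∉ B)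
  z ∉? B = ¬? (z ∈? B)

  outside : List A → List A → List A
  outside B T = filter (_∉? B) T

  length-split : ∀ {B T} → Unique B → Unique T → B ⊆ T →
                 length T ≡ length B + length (outside B T)
  length-split {B} {T} uB uT B⊆T = ≡.trans
      (↭-length (∼bag⇒↭ (unique∧set⇒bag uT uBT (mk⇔ into back))))
      (length-++ B)
    where
      uBT : Unique (B ++ outside B T)
      uBT = Unique.++⁺ uB (Unique.filter⁺ (_∉? B) uT) λ (z∈B , z∈T') → proj₂ (∈-filter⁻ (_∉? B) {xs = T} z∈T') z∈B
      into : ∀ {z} → z ∈ T → z ∈ B ++ outside B T
      into {z} z∈T with z ∈? B
      ... | yes z∈B = ∈-++⁺ˡ z∈B
      ... | no  z∉B = ∈-++⁺ʳ B (∈-filter⁺ (_∉? B) z∈T z∉B)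
      back : ∀ {z} → z ∈ B ++ outside B T → z ∈ T
      back z∈ with ∈-++⁻ B z∈
      ... | inj₁ z∈B  = B⊆T z∈B
      ... | inj₂ z∈T' = proj₁ (∈-filter⁻ (_∉? B) {xs = T} z∈T')

  module BlockCounting
    (block : A → List A) (k : ℕ)
    (block-self   : ∀ t → t ∈ block t)
    (block-sym    : ∀ {t z} → z ∈ block t → t ∈ block z)
    (block-trans  : ∀ {t z w} → z ∈ block t → w ∈ block z → w ∈ block t)
    (block-unique : ∀ t → Unique (block t))
    (block-size   : ∀ t → length (block t) ≡ k)
    where

    UnionOfBlocks : List A → Set a
    UnionOfBlocks T = ∀ {t z} → t ∈ T → z ∈ block t → z ∈ T

    outside-union : ∀ {T} t → UnionOfBlocks T → UnionOfBlocks (outside (block t) T)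
    outside-union {T} t closed t'∈T' z∈block
      with ∈-filter⁻ (_∉? block t) {xs = T} t'∈T'
    ... | t'∈T , t'∉block = ∈-filter⁺ (_∉? block t) (closed t'∈T z∈block)
                              λ z∈block-t → t'∉block (block-trans z∈block-t (block-sym z∈block))

    k-positive : A → 0 < k
    k-positive t with block t | block-self t | block-size t
    ... | _ ∷ _ | _ | ≡.refl = s≤s z≤n

    k∣length : ∀ T → Unique T → UnionOfBlocks T → k ∣ length T
    k∣length T = <-rec Goal divides-at (length T) T ≡.refl
      where
        Goal : ℕ → Set a
        Goal n = ∀ T → length T ≡ n → Unique T → UnionOfBlocks T → k ∣ n

        divides-at : ∀ n → (∀ {m} → m < n → Goal m) → Goal n
        divides-at n rec [] ≡.refl _ _ = k ∣0
        divides-at n rec T@(t ∷ _) ≡.refl unique closed =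
          ≡.subst (k ∣_) (≡.sym split) (∣m∣n⇒∣m+n ∣-refl k∣rest)
          where
            T' : List A
            T' = outside (block t) T
            split : length T ≡ k + length T'
            split = ≡.trans (length-split (block-unique t) unique (closed (here ≡.refl)))
                          (≡.cong (_+ length T') (block-size t))
            k∣rest : k ∣ length T'
            k∣rest = rec (≡.subst (length T' <_) (≡.sym split) (m<n+m _ (k-positive t)))
                         T' ≡.refl (Unique.filter⁺ (_∉? block t) unique) (outside-union t closed)

least : ∀ {p} {P : ℕ → Set p} → Decidable P → ∀ {m} → P m →
        ∃ λ k → P k × (∀ {j} → j < k → ¬ P j)
least {P = P} P? {m} = <-rec Goal search m
  where
    Goal : ℕ → Set _
    Goal m = P m → ∃ λ k → P k × (∀ {j} → j < k → ¬ P j)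
    search : ∀ m → (∀ {j} → j < m → Goal j) → Goal m
    search m rec Pm with anyUpTo? P? m
    ... | yes (j , j<m , Pj) = rec j<m Pj
    ... | no  none           = m , Pm , λ j<m Pj → none (_ , j<m , Pj)

module Powers {c ℓ} (G : Group c ℓ) where
  open Group G
  open import Algebra.Properties.Monoid.Mult monoid
    using (×-congʳ; ×-homo-+; ×-assocˡ; ×-idem) renaming (_×_ to _·_)

  infixr 8 _^_
  _^_ : Carrier → ℕ → Carrier
  a ^ m = m · a

  ^-cong : ∀ {a b} m → a ≈ b → a ^ m ≈ b ^ m
  ^-cong m = ×-congʳ m

  ^-+ : ∀ a i j → a ^ (i + j) ≈ a ^ i ∙ a ^ j
  ^-+ = ×-homo-+

  ^-* : ∀ a i j → (a ^ i) ^ j ≈ a ^ (j * i)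
  ^-* a i j = ×-assocˡ a j i

  ε^ : ∀ j → ε ^ j ≈ ε
  ε^ zero    = refl
  ε^ (suc j) = ×-idem (identityˡ ε) (suc j)

  ^-multiple : ∀ {a k} q → a ^ k ≈ ε → a ^ (q * k) ≈ ε
  ^-multiple {a} {k} q ak≈ε = trans (sym (^-* a k q)) (trans (^-cong q ak≈ε) (ε^ q))

  ^-gap : ∀ a {i j} → i < j → a ^ i ≈ a ^ j → a ^ (j ∸ i) ≈ ε
  ^-gap a {i} {j} i<j aⁱ≈aʲ = GroupProperties.∙-cancelʳ G (a ^ i) _ _ (begin
      a ^ (j ∸ i) ∙ a ^ i  ≈⟨ sym (^-+ a (j ∸ i) i) ⟩
      a ^ (j ∸ i + i)      ≡⟨ ≡.cong (a ^_) (m∸n+n≡m (<⇒≤ i<j)) ⟩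
      a ^ j                ≈⟨ sym aⁱ≈aʲ ⟩
      a ^ i                ≈⟨ sym (identityˡ _) ⟩
      ε ∙ a ^ i            ∎)
    where open import Relation.Binary.Reasoning.Setoid setoid

  ^-act : ∀ a i j g → a ^ i ∙ (a ^ j ∙ g) ≈ a ^ (i + j) ∙ g
  ^-act a i j g = trans (sym (assoc _ _ _)) (∙-congʳ (sym (^-+ a i j)))

-- The order k of a is the least positive exponent killing a; the
-- cosets {a ^ i ∙ g | i < k} then partition G into blocks of size k, so k ∣ n.
module Lagrange {c ℓ} (G : Group c ℓ) {n : ℕ} (|G|≡n : HasOrder G n) where
  open Group G
  open Powers G
  open Inverse |G|≡n using (to; from; to-cong; from-cong; strictlyInverseˡ; strictlyInverseʳ)
  open import Relation.Binary.Reasoning.Setoid setoid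

  -- numbering the elements of G by Fin n makes equality in G decidable
  to-injective : ∀ {g h} → to g ≡ to h → g ≈ h
  to-injective {g} {h} e = begin
    g             ≈⟨ sym (strictlyInverseʳ g) ⟩
    from (to g)   ≈⟨ from-cong e ⟩
    from (to h)   ≈⟨ strictlyInverseʳ h ⟩
    h             ∎

  infix 4 _≈?_
  _≈?_ : ∀ g h → Dec (g ≈ h)
  g ≈? h with to g Fin.≟ to h
  ... | yes e = yes (to-injective e)
  ... | no ¬e = no λ g≈h → ¬e (to-cong g≈h)

  module _ (a : Carrier) where

    Kills : ℕ → Set ℓ
    Kills k = 0 < k × a ^ k ≈ ε

    kills? : Decidable Kills
    kills? k = (0 <? k) ×-dec (a ^ k ≈? ε)

    -- (opaque: the search for the least exponent is never unfolded by the type checker)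
    opaque
      -- among a ^ 0, …, a ^ n two powers coincide (pigeonhole), so a is killed
      some-kill : ∃ Kills
      some-kill with Fin.pigeonhole (n<1+n n) (λ (i : Fin (suc n)) → to (a ^ toℕ i))
      ... | i , j , i<j , e = toℕ j ∸ toℕ i , m<n⇒0<n∸m i<j , ^-gap a i<j (to-injective e)

      order-spec : ∃ λ k → Kills k × (∀ {j} → j < k → ¬ Kills j)
      order-spec = least kills? (proj₂ some-kill)

    k : ℕ
    k = proj₁ order-spec

    0<k : 0 < k
    0<k = proj₁ (proj₁ (proj₂ order-spec))

    aᵏ≈ε : a ^ k ≈ ε
    aᵏ≈ε = proj₂ (proj₁ (proj₂ order-spec))

    k-least : ∀ {j} → j < k → ¬ Kills j
    k-least = proj₂ (proj₂ order-spec)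

    instance
      k-nonZero : NonZero k
      k-nonZero = >-nonZero 0<k

    ^-mod : ∀ m → a ^ m ≈ a ^ (m % k)
    ^-mod m = begin
      a ^ m                        ≡⟨ ≡.cong (a ^_) (m≡m%n+[m/n]*n m k) ⟩
      a ^ (m % k + (m / k) * k)    ≈⟨ ^-+ a (m % k) _ ⟩
      a ^ (m % k) ∙ a ^ ((m / k) * k) ≈⟨ ∙-congˡ (^-multiple (m / k) aᵏ≈ε) ⟩
      a ^ (m % k) ∙ ε              ≈⟨ identityʳ _ ⟩
      a ^ (m % k)                  ∎

    coset : Fin n → List (Fin n)
    coset t = applyUpTo (λ i → to (a ^ i ∙ from t)) k

    ∈-coset⁺ : ∀ {z t} m → from z ≈ a ^ m ∙ from t → z ∈ coset t
    ∈-coset⁺ {z} {t} m e = ≡.subst (_∈ coset t) z≡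
        (∈-applyUpTo⁺ (λ i → to (a ^ i ∙ from t)) (m%n<n m k))
      where
        z≡ : to (a ^ (m % k) ∙ from t) ≡ z
        z≡ = ≡.trans (to-cong (trans (∙-congʳ (sym (^-mod m))) (sym e))) (strictlyInverseˡ z)

    ∈-coset⁻ : ∀ {z t} → z ∈ coset t → ∃ λ i → i < k × from z ≈ a ^ i ∙ from t
    ∈-coset⁻ z∈ with ∈-applyUpTo⁻ _ z∈
    ... | i , i<k , ≡.refl = i , i<k , strictlyInverseʳ _

    coset-self : ∀ t → t ∈ coset t
    coset-self t = ∈-coset⁺ 0 (sym (identityˡ _))

    coset-sym : ∀ {t z} → z ∈ coset t → t ∈ coset z
    coset-sym {t} {z} z∈ with ∈-coset⁻ z∈
    ... | i , i<k , e = ∈-coset⁺ (k ∸ i) (begin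
      from t                        ≈⟨ sym (identityˡ _) ⟩
      ε ∙ from t                    ≈⟨ ∙-congʳ (sym aᵏ≈ε) ⟩
      a ^ k ∙ from t                ≡⟨ ≡.cong (λ m → a ^ m ∙ from t) (≡.sym (m∸n+n≡m (<⇒≤ i<k))) ⟩
      a ^ (k ∸ i + i) ∙ from t      ≈⟨ sym (^-act a (k ∸ i) i (from t)) ⟩
      a ^ (k ∸ i) ∙ (a ^ i ∙ from t) ≈⟨ ∙-congˡ (sym e) ⟩
      a ^ (k ∸ i) ∙ from z          ∎)

    coset-trans : ∀ {t z w} → z ∈ coset t → w ∈ coset z → w ∈ coset t
    coset-trans {t} {z} {w} z∈ w∈ with ∈-coset⁻ z∈ | ∈-coset⁻ w∈
    ... | i , _ , eᵢ | j , _ , eⱼ = ∈-coset⁺ (j + i) (begin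
      from w                         ≈⟨ eⱼ ⟩
      a ^ j ∙ from z                 ≈⟨ ∙-congˡ eᵢ ⟩
      a ^ j ∙ (a ^ i ∙ from t)       ≈⟨ ^-act a j i (from t) ⟩
      a ^ (j + i) ∙ from t           ∎)

    -- a ^ i ∙ g for i < k are pairwise distinct, by minimality of k
    coset-unique : ∀ t → Unique (coset t)
    coset-unique t = Unique.applyUpTo⁺₁ _ k λ {i} {j} i<j j<k e →
      k-least (≤-<-trans (m∸n≤m j i) j<k)
        (m<n⇒0<n∸m i<j , ^-gap a i<j (GroupProperties.∙-cancelʳ G (from t) _ _ (to-injective e)))

    coset-size : ∀ t → length (coset t) ≡ k
    coset-size t = length-applyUpTo _ k

    open BlockCounting Fin._≟_ coset k coset-self coset-sym coset-trans coset-unique coset-size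
      using (k∣length)

    order∣n : k ∣ n
    order∣n = ≡.subst (k ∣_) (length-tabulate (λ i → i))
      (k∣length (allFin n) (Unique.allFin⁺ n) (λ _ _ → ∈-allFin _))

    lagrange : a ^ n ≈ ε
    lagrange with order∣n
    ... | divides q n≡qk = trans (reflexive (≡.cong (a ^_) n≡qk)) (^-multiple q aᵏ≈ε)

module Coprime {c ℓ} (G : Group c ℓ) where
  open Group G
  open Powers G

  private
    trivial-by : ∀ {a m n} p q → 1 + q * n ≡ p * m → a ^ m ≈ ε → a ^ n ≈ ε → a ≈ ε
    trivial-by {a} {m} {n} p q eq aᵐ≈ε aⁿ≈ε = begin
        a                  ≈⟨ sym (identityʳ a) ⟩
        a ∙ ε              ≈⟨ ∙-congˡ (sym (^-multiple q aⁿ≈ε)) ⟩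
        a ^ (1 + q * n)    ≡⟨ ≡.cong (a ^_) eq ⟩
        a ^ (p * m)        ≈⟨ ^-multiple p aᵐ≈ε ⟩
        ε                  ∎
      where open import Relation.Binary.Reasoning.Setoid setoid

  coprime-trivial : ∀ {a} m n → gcd m n ≡ 1 → a ^ m ≈ ε → a ^ n ≈ ε → a ≈ ε
  coprime-trivial m n gcd≡1 aᵐ≈ε aⁿ≈ε
    with ≡.subst (λ d → Bézout.Identity d m n) gcd≡1 (Bézout.identity (gcd-GCD m n))
  ... | Bézout.+- p q eq = trivial-by p q eq aᵐ≈ε aⁿ≈ε
  ... | Bézout.-+ p q eq = trivial-by q p eq aⁿ≈ε aᵐ≈ε

cancels⇒inverse : ∀ l l' → cancels l l' ≡ true → l' ≡ invLetter l
cancels⇒inverse (false , X) (true  , X) _ = ≡.refl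
cancels⇒inverse (true  , X) (false , X) _ = ≡.refl
cancels⇒inverse (false , Y) (true  , Y) _ = ≡.refl
cancels⇒inverse (true  , Y) (false , Y) _ = ≡.refl
cancels⇒inverse (false , X) (false , X) ()
cancels⇒inverse (true  , X) (true  , X) ()
cancels⇒inverse (false , Y) (false , Y) ()
cancels⇒inverse (true  , Y) (true  , Y) ()
cancels⇒inverse (_ , X) (_ , Y) ()
cancels⇒inverse (_ , Y) (_ , X) ()

module Words {c ℓ} (G : Group c ℓ) where
  open Group G
  open Powers G
  open import Relation.Binary.Reasoning.Setoid setoid

  evalLetter-cong : ∀ {x x' y y'} → x ≈ x' → y ≈ y' → ∀ l → evalLetter G x y l ≈ evalLetter G x' y' l
  evalLetter-cong x≈ y≈ (false , X) = x≈
  evalLetter-cong x≈ y≈ (true  , X) = ⁻¹-cong x≈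
  evalLetter-cong x≈ y≈ (false , Y) = y≈
  evalLetter-cong x≈ y≈ (true  , Y) = ⁻¹-cong y≈

  eval-cong : ∀ {x x' y y'} → x ≈ x' → y ≈ y' → ∀ w → eval G x y w ≈ eval G x' y' w
  eval-cong x≈ y≈ []      = refl
  eval-cong x≈ y≈ (l ∷ w) = ∙-cong (evalLetter-cong x≈ y≈ l) (eval-cong x≈ y≈ w)

  eval-subst : ∀ x y u v w → eval G x y (substW u v w) ≈ eval G (eval G x y u) (eval G x y v) w
  eval-subst x y u v []      = refl
  eval-subst x y u v (l ∷ w) = trans (eval-++ G x y (substLetter u v l) (substW u v w))
                                     (∙-cong (letter l) (eval-subst x y u v w))
    where
      letter : ∀ l → eval G x y (substLetter u v l) ≈ evalLetter G (eval G x y u) (eval G x y v) l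
      letter (false , X) = refl
      letter (true  , X) = eval-inv G x y u
      letter (false , Y) = refl
      letter (true  , Y) = eval-inv G x y v

  eval-push : ∀ x y l w → eval G x y (push l w) ≈ evalLetter G x y l ∙ eval G x y w
  eval-push x y l []       = refl
  eval-push x y l (l' ∷ w) with cancels l l' in cancel
  ... | false = refl
  ... | true  = begin
    eval G x y w                                           ≈⟨ sym (identityˡ _) ⟩
    ε ∙ eval G x y w                                       ≈⟨ ∙-congʳ (sym (inverseʳ _)) ⟩
    (evalLetter G x y l ∙ evalLetter G x y l ⁻¹) ∙ eval G x y w
      ≈⟨ ∙-congʳ (∙-congˡ (sym (evalLetter-inv G x y l))) ⟩
    (evalLetter G x y l ∙ evalLetter G x y (invLetter l)) ∙ eval G x y w
      ≡⟨ ≡.cong (λ l'' → (evalLetter G x y l ∙ evalLetter G x y l'') ∙ eval G x y w)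
                (≡.sym (cancels⇒inverse l l' cancel)) ⟩
    (evalLetter G x y l ∙ evalLetter G x y l') ∙ eval G x y w ≈⟨ assoc _ _ _ ⟩
    evalLetter G x y l ∙ (evalLetter G x y l' ∙ eval G x y w) ∎

  eval-reduce : ∀ x y w → eval G x y (reduce w) ≈ eval G x y w
  eval-reduce x y []      = refl
  eval-reduce x y (l ∷ w) = trans (eval-push x y l (reduce w)) (∙-congˡ (eval-reduce x y w))

  eval-≈Δ : ∀ x y {w w'} → w ≈Δ w' → eval G x y w ≈ eval G x y w'
  eval-≈Δ x y {w} {w'} w≈w' = begin
    eval G x y w           ≈⟨ sym (eval-reduce x y w) ⟩
    eval G x y (reduce w)  ≡⟨ ≡.cong (eval G x y) w≈w' ⟩
    eval G x y (reduce w') ≈⟨ eval-reduce x y w' ⟩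
    eval G x y w'          ∎

  eval-inverse-subst : ∀ u v u' v' → substW u v u' ≈Δ ((false , X) ∷ []) → substW u v v' ≈Δ ((false , Y) ∷ []) →
    ∀ x y w → eval G (eval G (eval G x y u) (eval G x y v) u') (eval G (eval G x y u) (eval G x y v) v') w
              ≈ eval G x y w
  eval-inverse-subst u v u' v' στX στY x y = eval-cong (back u' στX) (back v' στY)
    where
      back : ∀ t {l} → substW u v t ≈Δ (l ∷ []) →
             eval G (eval G x y u) (eval G x y v) t ≈ evalLetter G x y l
      back t {l} e = trans (sym (eval-subst x y u v t)) (trans (eval-≈Δ x y {substW u v t} {l ∷ []} e) (identityʳ _))

  eval-power : ∀ x y m w → eval G x y (concat (replicate m w)) ≈ eval G x y w ^ m
  eval-power x y zero    w = refl
  eval-power x y (suc m) w = trans (eval-++ G x y w _) (∙-congˡ (eval-power x y m w))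

  Relation : Carrier → Carrier → Word → Word → Set ℓ
  Relation x y w w' = eval G x y w ≈ eval G x y w'

  relation-cong : ∀ {x x' y y'} → x ≈ x' → y ≈ y' → ∀ w w' → Relation x y w w' → Relation x' y' w w'
  relation-cong x≈ y≈ w w' rel = trans (sym (eval-cong x≈ y≈ w)) (trans rel (eval-cong x≈ y≈ w'))

  Respects : Carrier → Carrier → Word → Word → Set ℓ
  Respects x y u v = ∀ w w' → Relation x y w w' → Relation (eval G x y u) (eval G x y v) w w'

  eval-quotient : ∀ x y w w' → eval G x y (w ++ invWord w') ≈ eval G x y w ∙ eval G x y w' ⁻¹
  eval-quotient x y w w' = trans (eval-++ G x y w (invWord w')) (∙-congˡ (eval-inv G x y w'))

  relation⇒trivial : ∀ {x y} w w' → Relation x y w w' → eval G x y (w ++ invWord w') ≈ ε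
  relation⇒trivial {x} {y} w w' w≈w' =
    trans (eval-quotient x y w w') (GroupProperties.x≈y⇒x∙y⁻¹≈ε G w≈w')

  trivial⇒relation : ∀ {x y} w w' → eval G x y (w ++ invWord w') ≈ ε → Relation x y w w'
  trivial⇒relation {x} {y} w w' trivial =
    GroupProperties.x∙y⁻¹≈ε⇒x≈y G _ _ (trans (sym (eval-quotient x y w w')) trivial)

module _ {c₁ ℓ₁ c₂ ℓ₂} {G : Group c₁ ℓ₁} {K : Group c₂ ℓ₂} where
  private
    module G = Group G
    module K = Group K
  open GroupMorphisms G.rawGroup K.rawGroup using (IsGroupHomomorphism)

  eval-hom : ∀ {h} → IsGroupHomomorphism h →
             ∀ x y w → h (eval G x y w) K.≈ eval K (h x) (h y) w
  eval-hom {h} hom x y []      = IsGroupHomomorphism.ε-homo hom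
  eval-hom {h} hom x y (l ∷ w) =
    K.trans (IsGroupHomomorphism.homo hom _ _) (K.∙-cong (letter l) (eval-hom hom x y w))
    where
      letter : ∀ l → h (evalLetter G x y l) K.≈ evalLetter K (h x) (h y) l
      letter (false , X) = K.refl
      letter (true  , X) = IsGroupHomomorphism.⁻¹-homo hom x
      letter (false , Y) = K.refl
      letter (true  , Y) = IsGroupHomomorphism.⁻¹-homo hom y

-- The hypotheses say that
-- σ ∘ τ and τ ∘ σ fix X and Y in Δ (substW u v w is σ(w)).
module SymmetryCriterion {c ℓ} (G : Group c ℓ) (x y : Group.Carrier G) (u v u' v' : Word)
  (στX : substW u v u' ≈Δ ((false , X) ∷ [])) (στY : substW u v v' ≈Δ ((false , Y) ∷ []))
  (τσX : substW u' v' u ≈Δ ((false , X) ∷ [])) (τσY : substW u' v' v ≈Δ ((false , Y) ∷ []))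
  where
  open Group G
  open Words G
  open GroupMorphisms rawGroup rawGroup using (IsGroupIsomorphism; module IsGroupIsomorphism)
  open import Relation.Binary.Reasoning.Setoid setoid

  xσ yσ xτ yτ : Carrier
  xσ = eval G x y u
  yσ = eval G x y v
  xτ = eval G x y u'
  yτ = eval G x y v'

  τ-after-σ : ∀ w → eval G (eval G xσ yσ u') (eval G xσ yσ v') w ≈ eval G x y w
  τ-after-σ = eval-inverse-subst u v u' v' στX στY x y

  σ-after-τ : ∀ w → eval G (eval G xτ yτ u) (eval G xτ yτ v) w ≈ eval G x y w
  σ-after-τ = eval-inverse-subst u' v' u v τσX τσY x y

  hasSymmetry⇒respects : HasSymmetry G x y u v → Respects x y u v × Respects x y u' v'
  hasSymmetry⇒respects (f , iso , fx≈ , fy≈) = respects-σ , respects-τ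
    where
      open IsGroupIsomorphism iso using (isGroupHomomorphism; ⟦⟧-cong; injective)

      f-σ : ∀ w → f (eval G x y w) ≈ eval G xσ yσ w
      f-σ w = trans (eval-hom isGroupHomomorphism x y w) (eval-cong fx≈ fy≈ w)

      f-τ : ∀ w → f (eval G xτ yτ w) ≈ eval G x y w
      f-τ w = trans (eval-hom isGroupHomomorphism xτ yτ w)
                    (trans (eval-cong (f-σ u') (f-σ v') w) (τ-after-σ w))

      respects-σ : Respects x y u v
      respects-σ w w' rel = trans (sym (f-σ w)) (trans (⟦⟧-cong rel) (f-σ w'))

      respects-τ : Respects x y u' v'
      respects-τ w w' rel = injective (trans (f-τ w) (trans rel (sym (f-τ w'))))

  module Induced (gen : Generates G x y) (respects-σ : Respects x y u v) (respects-τ : Respects x y u' v') where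
    word : Carrier → Word
    word g = proj₁ (gen g)

    word-spec : ∀ g → eval G x y (word g) ≈ g
    word-spec g = proj₂ (gen g)

    f : Carrier → Carrier
    f g = eval G xσ yσ (word g)

    f-σ : ∀ w → f (eval G x y w) ≈ eval G xσ yσ w
    f-σ w = respects-σ (word _) w (word-spec _)

    f-cong : ∀ {g h} → g ≈ h → f g ≈ f h
    f-cong {g} {h} g≈h = respects-σ (word g) (word h) (trans (word-spec g) (trans g≈h (sym (word-spec h))))

    f-on : ∀ {g} w → eval G x y w ≈ g → f g ≈ eval G xσ yσ w
    f-on w e = trans (f-cong (sym e)) (f-σ w)

    f-homo : ∀ g h → f (g ∙ h) ≈ f g ∙ f h
    f-homo g h = trans (f-on (word g ++ word h)
        (trans (eval-++ G x y (word g) (word h)) (∙-cong (word-spec g) (word-spec h))))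
      (eval-++ G xσ yσ (word g) (word h))

    f-ε : f ε ≈ ε
    f-ε = f-on [] refl

    f-⁻¹ : ∀ g → f (g ⁻¹) ≈ f g ⁻¹
    f-⁻¹ g = trans (f-on (invWord (word g)) (trans (eval-inv G x y (word g)) (⁻¹-cong (word-spec g))))
                   (eval-inv G xσ yσ (word g))

    f-injective : ∀ {g h} → f g ≈ f h → g ≈ h
    f-injective {g} {h} fg≈fh = begin
      g                                     ≈⟨ sym (word-spec g) ⟩
      eval G x y (word g)                   ≈⟨ sym (σ-after-τ (word g)) ⟩
      eval G (eval G xτ yτ u) (eval G xτ yτ v) (word g) ≈⟨ sym (eval-subst xτ yτ u v (word g)) ⟩
      eval G xτ yτ (substW u v (word g))    ≈⟨ respects-τ (substW u v (word g)) (substW u v (word h)) σ-relation ⟩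
      eval G xτ yτ (substW u v (word h))    ≈⟨ eval-subst xτ yτ u v (word h) ⟩
      eval G (eval G xτ yτ u) (eval G xτ yτ v) (word h) ≈⟨ σ-after-τ (word h) ⟩
      eval G x y (word h)                   ≈⟨ word-spec h ⟩
      h                                     ∎
      where
        σ-relation : Relation x y (substW u v (word g)) (substW u v (word h))
        σ-relation = trans (eval-subst x y u v (word g)) (trans fg≈fh (sym (eval-subst x y u v (word h))))

    -- g has the preimage τ(g) = w(xτ, yτ) for any word w representing g
    f-surjective : ∀ g → ∃ λ g₀ → ∀ {z} → z ≈ g₀ → f z ≈ g
    f-surjective g = eval G xτ yτ (word g) , λ {z} z≈ → begin
      f z                                   ≈⟨ f-on (substW u' v' (word g)) (trans (eval-subst x y u' v' (word g)) (sym z≈)) ⟩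
      eval G xσ yσ (substW u' v' (word g))  ≈⟨ eval-subst xσ yσ u' v' (word g) ⟩
      eval G (eval G xσ yσ u') (eval G xσ yσ v') (word g) ≈⟨ τ-after-σ (word g) ⟩
      eval G x y (word g)                   ≈⟨ word-spec g ⟩
      g                                     ∎

    f-x : f x ≈ xσ
    f-x = trans (f-on ((false , X) ∷ []) (identityʳ x)) (identityʳ xσ)

    f-y : f y ≈ yσ
    f-y = trans (f-on ((false , Y) ∷ []) (identityʳ y)) (identityʳ yσ)

    iso : IsGroupIsomorphism f
    iso = record
      { isGroupMonomorphism = record
        { isGroupHomomorphism = record
          { isMonoidHomomorphism = record
            { isMagmaHomomorphism = record
              { isRelHomomorphism = record { cong = f-cong }
              ; homo = f-homo }
            ; ε-homo = f-ε }
          ; ⁻¹-homo = f-⁻¹ }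
        ; injective = f-injective }
      ; surjective = f-surjective }


  respects⇒hasSymmetry : Generates G x y → Respects x y u v → Respects x y u' v' →
                         HasSymmetry G x y u v
  respects⇒hasSymmetry gen respects-σ respects-τ = f , iso , f-x , f-y
    where open Induced gen respects-σ respects-τ

  symmetry⇔respects : Generates G x y → HasSymmetry G x y u v ⇔ (Respects x y u v × Respects x y u' v')
  symmetry⇔respects gen = mk⇔ hasSymmetry⇒respects λ (σ , τ) → respects⇒hasSymmetry gen σ τ

module Generated {c ℓ} (H : Group c ℓ) (x y : Group.Carrier H) where
  open Group H

  gx gy : Group.Carrier (generated H x y)
  gx = (x , (false , X) ∷ [] , identityʳ x)
  gy = (y , (false , Y) ∷ [] , identityʳ y)

  eval-generated : ∀ a b w → proj₁ (eval (generated H x y) a b w) ≡ eval H (proj₁ a) (proj₁ b) w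
  eval-generated a b []      = ≡.refl
  eval-generated a b (l ∷ w) = ≡.cong₂ _∙_ (letter l) (eval-generated a b w)
    where
      letter : ∀ l → proj₁ (evalLetter (generated H x y) a b l) ≡ evalLetter H (proj₁ a) (proj₁ b) l
      letter (false , X) = ≡.refl
      letter (true  , X) = ≡.refl
      letter (false , Y) = ≡.refl
      letter (true  , Y) = ≡.refl

  generates : Generates (generated H x y) gx gy
  generates (g , w , w≈g) = w , trans (reflexive (eval-generated gx gy w)) w≈g

eval-pair : ∀ {c₁ ℓ₁ c₂ ℓ₂} (G₁ : Group c₁ ℓ₁) (G₂ : Group c₂ ℓ₂) a b w →
  eval (DP.group G₁ G₂) a b w ≡ (eval G₁ (proj₁ a) (proj₁ b) w , eval G₂ (proj₂ a) (proj₂ b) w)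
eval-pair G₁ G₂ a b []      = ≡.refl
eval-pair G₁ G₂ a b (l ∷ w) = ≡.cong₂ (Group._∙_ (DP.group G₁ G₂)) (letter l) (eval-pair G₁ G₂ a b w)
  where
    letter : ∀ l → evalLetter (DP.group G₁ G₂) a b l
                   ≡ (evalLetter G₁ (proj₁ a) (proj₁ b) l , evalLetter G₂ (proj₂ a) (proj₂ b) l)
    letter (false , X) = ≡.refl
    letter (true  , X) = ≡.refl
    letter (false , Y) = ≡.refl
    letter (true  , Y) = ≡.refl

RespectsJointly : ∀ {c₁ ℓ₁ c₂ ℓ₂} (G₁ : Group c₁ ℓ₁) (G₂ : Group c₂ ℓ₂) →
  Group.Carrier G₁ → Group.Carrier G₁ → Group.Carrier G₂ → Group.Carrier G₂ → Word → Word → Set (ℓ₁ ⊔ ℓ₂)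
RespectsJointly G₁ G₂ x₁ y₁ x₂ y₂ u v = ∀ w w' →
  Words.Relation G₁ x₁ y₁ w w' × Words.Relation G₂ x₂ y₂ w w' →
  Words.Relation G₁ (eval G₁ x₁ y₁ u) (eval G₁ x₁ y₁ v) w w' × Words.Relation G₂ (eval G₂ x₂ y₂ u) (eval G₂ x₂ y₂ v) w w'

module Parallel {c₁ ℓ₁ c₂ ℓ₂} (G₁ : Group c₁ ℓ₁) (G₂ : Group c₂ ℓ₂)
  (x₁ y₁ : Group.Carrier G₁) (x₂ y₂ : Group.Carrier G₂) where
  private
    module G₁ = Group G₁
    module G₂ = Group G₂
    module W₁ = Words G₁
    module W₂ = Words G₂
    G₁×G₂ : Group _ _
    G₁×G₂ = DP.group G₁ G₂
  open Generated G₁×G₂ (x₁ , x₂) (y₁ , y₂) public using (gx; gy; generates)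

  P : Group _ _
  P = generated G₁×G₂ (x₁ , x₂) (y₁ , y₂)

  open Words P using (Relation; Respects)

  component₁ : Group.Carrier P → G₁.Carrier
  component₁ a = proj₁ (proj₁ a)

  component₂ : Group.Carrier P → G₂.Carrier
  component₂ a = proj₂ (proj₁ a)

  eval-parallel : ∀ a b w → proj₁ (eval P a b w)
    ≡ (eval G₁ (component₁ a) (component₁ b) w , eval G₂ (component₂ a) (component₂ b) w)
  eval-parallel a b w = ≡.trans (Generated.eval-generated G₁×G₂ (x₁ , x₂) (y₁ , y₂) a b w)
                                (eval-pair G₁ G₂ (proj₁ a) (proj₁ b) w)

  relation-parallel : ∀ a b w w' → Relation a b w w' ⇔
    (W₁.Relation (component₁ a) (component₁ b) w w' × W₂.Relation (component₂ a) (component₂ b) w w')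
  relation-parallel a b w w' = mk⇔
    (≡.subst₂ (Group._≈_ G₁×G₂) (eval-parallel a b w) (eval-parallel a b w'))
    (≡.subst₂ (Group._≈_ G₁×G₂) (≡.sym (eval-parallel a b w)) (≡.sym (eval-parallel a b w')))

  respects⇔jointly : ∀ u v → Respects gx gy u v ⇔ RespectsJointly G₁ G₂ x₁ y₁ x₂ y₂ u v
  respects⇔jointly u v = mk⇔
    (λ respects w w' rel → images⇒ w w' (to (relation-parallel a b w w') (respects w w' (from (relation-parallel gx gy w w') rel))))
    (λ jointly w w' rel → from (relation-parallel a b w w') (images⇐ w w' (jointly w w' (to (relation-parallel gx gy w w') rel))))
    where
      open Equivalence
      a b : Group.Carrier P
      a = eval P gx gy u
      b = eval P gx gy v
      components : ∀ t → proj₁ (eval P gx gy t) ≡ (eval G₁ x₁ y₁ t , eval G₂ x₂ y₂ t)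
      components = eval-parallel gx gy
      a₁ : component₁ a G₁.≈ eval G₁ x₁ y₁ u
      a₁ = G₁.reflexive (≡.cong proj₁ (components u))
      b₁ : component₁ b G₁.≈ eval G₁ x₁ y₁ v
      b₁ = G₁.reflexive (≡.cong proj₁ (components v))
      a₂ : component₂ a G₂.≈ eval G₂ x₂ y₂ u
      a₂ = G₂.reflexive (≡.cong proj₂ (components u))
      b₂ : component₂ b G₂.≈ eval G₂ x₂ y₂ v
      b₂ = G₂.reflexive (≡.cong proj₂ (components v))

      images⇒ : ∀ w w' →
        W₁.Relation (component₁ a) (component₁ b) w w' × W₂.Relation (component₂ a) (component₂ b) w w' →
        W₁.Relation (eval G₁ x₁ y₁ u) (eval G₁ x₁ y₁ v) w w' × W₂.Relation (eval G₂ x₂ y₂ u) (eval G₂ x₂ y₂ v) w w'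
      images⇒ w w' (r₁ , r₂) = W₁.relation-cong a₁ b₁ w w' r₁ , W₂.relation-cong a₂ b₂ w w' r₂

      images⇐ : ∀ w w' →
        W₁.Relation (eval G₁ x₁ y₁ u) (eval G₁ x₁ y₁ v) w w' × W₂.Relation (eval G₂ x₂ y₂ u) (eval G₂ x₂ y₂ v) w w' →
        W₁.Relation (component₁ a) (component₁ b) w w' × W₂.Relation (component₂ a) (component₂ b) w w'
      images⇐ w w' (r₁ , r₂) = W₁.relation-cong (G₁.sym a₁) (G₁.sym b₁) w w' r₁ , W₂.relation-cong (G₂.sym a₂) (G₂.sym b₂) w w' r₂

-- A relation of (x₁, y₁) can be turned into a common relation of both pairs by
-- raising it to the exponent m of G₂; if G₁ has no m-torsion, joint preservation
-- therefore already forces preservation in G₁.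
module _ {c₁ ℓ₁ c₂ ℓ₂} {G₁ : Group c₁ ℓ₁} {G₂ : Group c₂ ℓ₂}
  {x₁ y₁ : Group.Carrier G₁} {x₂ y₂ : Group.Carrier G₂} where
  private
    module G₁ = Group G₁
    module G₂ = Group G₂
    module W₁ = Words G₁
    module W₂ = Words G₂
    module P₁ = Powers G₁
    module P₂ = Powers G₂

  jointly⇒respects₁ : ∀ m → (∀ b → b P₂.^ m G₂.≈ G₂.ε) → (∀ a → a P₁.^ m G₁.≈ G₁.ε → a G₁.≈ G₁.ε) →
    ∀ u v → RespectsJointly G₁ G₂ x₁ y₁ x₂ y₂ u v → W₁.Respects x₁ y₁ u v
  jointly⇒respects₁ m exponent torsion-free u v jointly w w' rel =
    W₁.trivial⇒relation w w' (torsion-free _ (G₁.trans (G₁.sym (W₁.eval-power x₁' y₁' m c)) image-relation))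
    where
      x₁' y₁' : G₁.Carrier
      x₁' = eval G₁ x₁ y₁ u
      y₁' = eval G₁ x₁ y₁ v
      c cᵐ : Word
      c = w ++ invWord w'
      cᵐ = concat (replicate m c)
      relation₁ : W₁.Relation x₁ y₁ cᵐ []
      relation₁ = G₁.trans (W₁.eval-power x₁ y₁ m c)
                    (G₁.trans (P₁.^-cong m (W₁.relation⇒trivial w w' rel)) (P₁.ε^ m))
      relation₂ : W₂.Relation x₂ y₂ cᵐ []
      relation₂ = G₂.trans (W₂.eval-power x₂ y₂ m c) (exponent _)
      image-relation : W₁.Relation x₁' y₁' cᵐ []
      image-relation = proj₁ (jointly cᵐ [] (relation₁ , relation₂))

jointly⇔respects : ∀ {c₁ ℓ₁ c₂ ℓ₂} {G₁ : Group c₁ ℓ₁} {G₂ : Group c₂ ℓ₂} {n₁ n₂}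
  {x₁ y₁ : Group.Carrier G₁} {x₂ y₂ : Group.Carrier G₂} →
  HasOrder G₁ n₁ → HasOrder G₂ n₂ → gcd n₁ n₂ ≡ 1 → ∀ u v →
  RespectsJointly G₁ G₂ x₁ y₁ x₂ y₂ u v ⇔ (Words.Respects G₁ x₁ y₁ u v × Words.Respects G₂ x₂ y₂ u v)
jointly⇔respects {G₁ = G₁} {G₂} {n₁} {n₂} |G₁|≡n₁ |G₂|≡n₂ gcd≡1 u v = mk⇔
  (λ jointly → jointly⇒respects₁ {G₁ = G₁} {G₂} n₂ (Lagrange.lagrange G₂ |G₂|≡n₂) torsion-free₁ u v jointly
             , jointly⇒respects₁ {G₁ = G₂} {G₁} n₁ (Lagrange.lagrange G₁ |G₁|≡n₁) torsion-free₂ u v (swapped jointly))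
  (λ (respects₁ , respects₂) w w' (rel₁ , rel₂) → respects₁ w w' rel₁ , respects₂ w w' rel₂)
  where
    open Group G₁ using () renaming (_≈_ to _≈₁_)
    open Group G₂ using () renaming (_≈_ to _≈₂_)
    torsion-free₁ : ∀ a → Powers._^_ G₁ a n₂ ≈₁ Group.ε G₁ → a ≈₁ Group.ε G₁
    torsion-free₁ a = Coprime.coprime-trivial G₁ n₁ n₂ gcd≡1 (Lagrange.lagrange G₁ |G₁|≡n₁ a)
    torsion-free₂ : ∀ a → Powers._^_ G₂ a n₁ ≈₂ Group.ε G₂ → a ≈₂ Group.ε G₂
    torsion-free₂ a = Coprime.coprime-trivial G₂ n₂ n₁ (≡.trans (gcd-comm n₂ n₁) gcd≡1) (Lagrange.lagrange G₂ |G₂|≡n₂ a)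
    swapped : ∀ {x₁ y₁ x₂ y₂} → RespectsJointly G₁ G₂ x₁ y₁ x₂ y₂ u v → RespectsJointly G₂ G₁ x₂ y₂ x₁ y₁ u v
    swapped jointly w w' rel = swap (jointly w w' (swap rel))

-- Products of logical equivalences, across universe levels (the library's _×-⇔_
-- requires all four types to live in one universe).
infixr 2 _×-⇔_
_×-⇔_ : ∀ {a b c d} {A : Set a} {B : Set b} {C : Set c} {D : Set d} →
  A ⇔ B → C ⇔ D → (A × C) ⇔ (B × D)
A⇔B ×-⇔ C⇔D = mk⇔ (map (to A⇔B) (to C⇔D)) (map (from A⇔B) (from C⇔D))
  where open Equivalence

×-interchange : ∀ {a b c d} {A : Set a} {B : Set b} {C : Set c} {D : Set d} →
  ((A × B) × (C × D)) ⇔ ((A × C) × (B × D))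
×-interchange = mk⇔ (λ ((a , b) , (c , d)) → (a , c) , (b , d)) (λ ((a , c) , (b , d)) → (a , b) , (c , d))

proposition3p6 : ∀ {c₁ ℓ₁ c₂ ℓ₂ : Level} (D₁ : Dessin c₁ ℓ₁) (D₂ : Dessin c₂ ℓ₂) →
    gcd (Dessin.order D₁) (Dessin.order D₂) ≡ 1 →
    (u v : Word) → IsAutΔ u v →
    HasSymmetry (parallelGroup D₁ D₂) (parallelX D₁ D₂) (parallelY D₁ D₂) u v
      ⇔ (HasSymmetry (Dessin.grp D₁) (Dessin.x D₁) (Dessin.y D₁) u v
         × HasSymmetry (Dessin.grp D₂) (Dessin.x D₂) (Dessin.y D₂) u v)
proposition3p6 D₁ D₂ gcd≡1 u v (u' , v' , στX , στY , τσX , τσY) = begin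
  HasSymmetry P gx gy u v
    ∼⟨ criterion P gx gy generates ⟩
  (RespectsP u v × RespectsP u' v')
    ∼⟨ respects⇔jointly u v ×-⇔ respects⇔jointly u' v' ⟩
  (RespectsJointly G₁ G₂ x₁ y₁ x₂ y₂ u v × RespectsJointly G₁ G₂ x₁ y₁ x₂ y₂ u' v')
    ∼⟨ split u v ×-⇔ split u' v' ⟩
  ((Respects₁ u v × Respects₂ u v) × (Respects₁ u' v' × Respects₂ u' v'))
    ∼⟨ ×-interchange ⟩
  ((Respects₁ u v × Respects₁ u' v') × (Respects₂ u v × Respects₂ u' v'))
    ∼⟨ ⇔-sym (criterion G₁ x₁ y₁ (Dessin.gen D₁)) ×-⇔ ⇔-sym (criterion G₂ x₂ y₂ (Dessin.gen D₂)) ⟩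
  (HasSymmetry G₁ x₁ y₁ u v × HasSymmetry G₂ x₂ y₂ u v) ∎
  where
    open EquationalReasoning
    open Dessin D₁ using () renaming (grp to G₁; x to x₁; y to y₁)
    open Dessin D₂ using () renaming (grp to G₂; x to x₂; y to y₂)
    open Parallel G₁ G₂ x₁ y₁ x₂ y₂ using (P; gx; gy; generates; respects⇔jointly)
    RespectsP : Word → Word → Set _
    RespectsP = Words.Respects P gx gy
    Respects₁ : Word → Word → Set _
    Respects₁ = Words.Respects G₁ x₁ y₁
    Respects₂ : Word → Word → Set _
    Respects₂ = Words.Respects G₂ x₂ y₂
    criterion : ∀ {c ℓ} (G : Group c ℓ) x y → Generates G x y →
                HasSymmetry G x y u v ⇔ (Words.Respects G x y u v × Words.Respects G x y u' v')
    criterion G x y = SymmetryCriterion.symmetry⇔respects G x y u v u' v' στX στY τσX τσY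
    split : ∀ u v → RespectsJointly G₁ G₂ x₁ y₁ x₂ y₂ u v ⇔ (Respects₁ u v × Respects₂ u v)
    split = jointly⇔respects (Dessin.finite D₁) (Dessin.finite D₂) gcd≡1
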